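{- Let $n>0$ and $k\in\{1,\dots,n\}$. Then (i) the number of elements of rank $k$ (i.e. of semilength $k$) in the interval $[UD,(UD)^n]$ of the Dyck pattern poset is $$s_0^{(k)}([UD,(UD)^n])=\sum_{m=\max\{1,2k-n\}}^{k}N_{k,m};$$ (ii) the number of elements of the interval $[UD,(UD)^n]$ is $$s_0([UD,(UD)^n])=\sum_{k=1}^{n}\sum_{m=\max\{1,2k-n\}}^{k}N_{k,m}.$$
   Context: A Dyck path of semilength $k$ is a word over $\{U,D\}$ with $k$ letters $U$ and $k$ letters $D$ such that every prefix contains at least as many $U$'s as $D$'s. The Dyck pattern poset is the set of nonempty Dyck paths ordered by $P\leq Q$ iff $P$ is a subword of $Q$ (obtained by deleting letters, not necessarily consecutive); it is graded with minimum $UD$ and rank function the semilength. $(UD)^n$ is $UD$ repeated $n$ times. $N_{k,m}$ is the Narayana number, the number of Dyck paths of semilength $k$ with exactly $m$ peaks (a peak is an occurrence of $UD$ as two consecutive letters); $N_{k,m}=\frac1k\binom{k}{m}\binom{k}{m-1}$ for $k,m\geq1$. -}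

module Defs where

open import Data.Nat using (ℕ; zero; suc; _+_; _*_; _∸_; _/_; _≤_; _≤?_; _⊔_)
open import Data.Nat.Combinatorics using (_C_)
open import Data.List using (List; []; _∷_; length; filter; map; concatMap; inits; replicate; concat; _++_; upTo)
open import Data.Nat.ListAction using (sum)
open import Data.List.Relation.Unary.All using (All; all?)
open import Data.Product using (_×_)
open import Relation.Nullary using (Dec; yes; no)
open import Relation.Nullary.Decidable using (_×-dec_)
open import Relation.Binary.PropositionalEquality using (_≡_; refl)
open import Relation.Binary using (DecidableEquality)
open import Data.List.Relation.Binary.Sublist.Propositional using (_⊆_)
import Data.List.Relation.Binary.Sublist.DecPropositional as DecSub

data Step : Set where
  U D : Step

_≟S_ : DecidableEquality Step
U ≟S U = yes refl
U ≟S D = no (λ ())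
D ≟S U = no (λ ())
D ≟S D = yes refl

numU : List Step → ℕ
numU [] = 0
numU (U ∷ w) = suc (numU w)
numU (D ∷ w) = numU w

numD : List Step → ℕ
numD [] = 0
numD (U ∷ w) = numD w
numD (D ∷ w) = suc (numD w)

IsDyck : List Step → Set
IsDyck w = (numU w ≡ numD w) × All (λ p → numD p ≤ numU p) (inits w)

isDyck? : (w : List Step) → Dec (IsDyck w)
isDyck? w = (numU w Data.Nat.≟ numD w) ×-dec all? (λ p → numD p ≤? numU p) (inits w)
  where import Data.Nat

semilength : List Step → ℕ
semilength w = numU w

UD : List Step
UD = U ∷ D ∷ []

UD^ : ℕ → List Step
UD^ n = concat (replicate n UD)

-- Pattern order: P ≤ Q iff P is a (not necessarily consecutive) subword of Q
_≼_ : List Step → List Step → Set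
P ≼ Q = P ⊆ Q

_≼?_ : (P Q : List Step) → Dec (P ≼ Q)
P ≼? Q = DecSub._⊆?_ _≟S_ P Q

words : ℕ → List (List Step)
words zero = [] ∷ []
words (suc m) = concatMap (λ w → (U ∷ w) ∷ (D ∷ w) ∷ []) (words m)

InIntervalRank : ℕ → ℕ → List Step → Set
InIntervalRank n k P = IsDyck P × (UD ≼ P) × (P ≼ UD^ n) × (semilength P ≡ k)

InIntervalRank? : ∀ n k P → Dec (InIntervalRank n k P)
InIntervalRank? n k P =
  isDyck? P ×-dec (UD ≼? P) ×-dec (P ≼? UD^ n) ×-dec (semilength P Data.Nat.≟ k)
  where import Data.Nat

rankCount : ℕ → ℕ → ℕ
rankCount n k = length (filter (InIntervalRank? n k) (words (2 * k)))

InInterval : ℕ → List Step → Set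
InInterval n P = IsDyck P × (UD ≼ P) × (P ≼ UD^ n)

InInterval? : ∀ n P → Dec (InInterval n P)
InInterval? n P = isDyck? P ×-dec (UD ≼? P) ×-dec (P ≼? UD^ n)

-- all words of length ≤ 2n (the interval's elements are subwords of (UD)^n, of length 2n)
wordsUpTo : ℕ → List (List Step)
wordsUpTo m = concatMap words (upTo (suc m))

intervalCount : ℕ → ℕ
intervalCount n = length (filter (InInterval? n) (wordsUpTo (2 * n)))

-- Narayana number N_{k,m} = (1/k) C(k,m) C(k,m-1)  (exact division for k,m ≥ 1)
narayana : ℕ → ℕ → ℕ
narayana zero m = 0
narayana (suc k') m = ((k C m) * (k C (m ∸ 1))) / k
  where k = suc k'

-- Σ_{m=a}^{b} f m  (empty when b < a)
sumFromTo : ℕ → ℕ → (ℕ → ℕ) → ℕ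
sumFromTo a b f = sum (map (λ i → f (a + i)) (upTo (suc b ∸ a)))

-- A Dyck path P of semilength k is a subword of (UD)^n iff it has at least 2k − n peaks:
-- embedding P greedily into UDUD… uses one letter per step of P plus one skipped letter
-- for each pair of equal adjacent steps, so the shortest alternating word containing P
-- has length 4k − 2·peaks(P). Hence the rank-k elements of [UD, (UD)^n] are the Dyck
-- paths of semilength k with between max(1, 2k − n) and k peaks, and (i) is the Narayana
-- count of Dyck paths by peaks; (ii) sums (i) over k, as no word of odd length is Dyck.
-- For the Narayana count, paths from height h down to 0 are counted by up-steps, peaks
-- and first letter: the first-step recurrences are solved by the ballot-type differences
-- C(s,t)·C(s+h,t+1) − C(s,t+1)·C(s+h,t), which at h = 0 give N_{k,m} by absorption.

module Submission where

open import Defs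
open import Data.Bool.Base using (true; false; if_then_else_)
open import Data.Empty using (⊥-elim)
open import Data.List using (List; []; _∷_; length; filter; map; concatMap; applyUpTo; _++_; inits; head)
open import Data.List.Relation.Binary.Sublist.Propositional using (_⊆_; []; _∷_; _∷ʳ_; minimum)
open import Data.List.Relation.Unary.All as All using (All; []; _∷_)
open import Data.List.Relation.Unary.All.Properties using (map⁺; map⁻)
open import Data.Maybe as Maybe using (Maybe; just; nothing)
import Data.Maybe.Properties as Maybe
open import Data.Nat
  using (ℕ; zero; suc; _+_; _*_; _∸_; _/_; _⊔_; _≤?_; _<?_; _<_; _≤_; _≟_; z≤n; s≤s; s≤s⁻¹)
open import Data.Nat.Combinatorics using (_C_; nCk+nC[k+1]≡[n+1]C[k+1]; nC1≡n)
open import Data.Nat.DivMod using (m*n/n≡m; n/n≡1)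
open import Data.Nat.ListAction using (sum)
open import Data.Nat.Properties
open import Algebra.Properties.CommutativeSemigroup +-commutativeSemigroup
  using () renaming (interchange to +-interchange)
open import Data.Nat.Tactic.RingSolver using (solve-∀)
open import Data.Product using (_×_; _,_)
open import Function using (_∘_; case_of_)
open import Function.Bundles using (_⇔_; mk⇔; Equivalence)
open import Relation.Binary.Definitions using (Tri; tri<; tri≈; tri>)
open import Relation.Binary.PropositionalEquality
open import Relation.Nullary using (Dec; yes; no; ¬_; does; contradiction)
open import Relation.Nullary.Decidable using (_×-dec_)

private variable
  A : Set
  P Q : Set

-- Only `does` is inspected, so δ (suc m) (suc n) reduces to δ m n.
𝟙 : Dec P → ℕ
𝟙 d = if does d then 1 else 0

𝟙-yes : (d : Dec P) → P → 𝟙 d ≡ 1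
𝟙-yes (yes _) _ = refl
𝟙-yes (no ¬p) p = contradiction p ¬p

𝟙-no : (d : Dec P) → ¬ P → 𝟙 d ≡ 0
𝟙-no (yes p) ¬p = contradiction p ¬p
𝟙-no (no _) _ = refl

𝟙-⇔ : P ⇔ Q → (p : Dec P) (q : Dec Q) → 𝟙 p ≡ 𝟙 q
𝟙-⇔ P⇔Q p (yes q) = 𝟙-yes p (Equivalence.from P⇔Q q)
𝟙-⇔ P⇔Q p (no ¬q) = 𝟙-no p (¬q ∘ Equivalence.to P⇔Q)

𝟙-× : (p : Dec P) (q : Dec Q) → 𝟙 (p ×-dec q) ≡ 𝟙 p * 𝟙 q
𝟙-× p q with does p
... | true = sym (+-identityʳ (𝟙 q))
... | false = refl

δ : ℕ → ℕ → ℕ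
δ m n = 𝟙 (m ≟ n)

δ-refl : ∀ m → δ m m ≡ 1
δ-refl m = 𝟙-yes (m ≟ m) refl

∑ : (A → ℕ) → List A → ℕ
∑ f [] = 0
∑ f (x ∷ xs) = f x + ∑ f xs

∑-cong : {f g : A → ℕ} (xs : List A) → (∀ x → f x ≡ g x) → ∑ f xs ≡ ∑ g xs
∑-cong [] f≗g = refl
∑-cong (x ∷ xs) f≗g = cong₂ _+_ (f≗g x) (∑-cong xs f≗g)

∑-zero : (xs : List A) → ∑ (λ _ → 0) xs ≡ 0
∑-zero [] = refl
∑-zero (x ∷ xs) = ∑-zero xs

∑-+ : (f g : A → ℕ) (xs : List A) → ∑ (λ x → f x + g x) xs ≡ ∑ f xs + ∑ g xs
∑-+ f g [] = refl
∑-+ f g (x ∷ xs) = begin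
  f x + g x + ∑ (λ x → f x + g x) xs ≡⟨ cong (f x + g x +_) (∑-+ f g xs) ⟩
  f x + g x + (∑ f xs + ∑ g xs)      ≡⟨ +-interchange (f x) (g x) (∑ f xs) (∑ g xs) ⟩
  f x + ∑ f xs + (g x + ∑ g xs)      ∎
  where open ≡-Reasoning

∑-++ : (f : A → ℕ) (xs ys : List A) → ∑ f (xs ++ ys) ≡ ∑ f xs + ∑ f ys
∑-++ f [] ys = refl
∑-++ f (x ∷ xs) ys = trans (cong (f x +_) (∑-++ f xs ys)) (sym (+-assoc (f x) _ _))

length-filter : {P : A → Set} (P? : ∀ x → Dec (P x)) → ∀ xs → length (filter P? xs) ≡ ∑ (𝟙 ∘ P?) xs
length-filter P? [] = refl
length-filter P? (x ∷ xs) with does (P? x)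
... | true = cong suc (length-filter P? xs)
... | false = length-filter P? xs

∑< : ℕ → (ℕ → ℕ) → ℕ
∑< zero g = 0
∑< (suc c) g = g 0 + ∑< c (g ∘ suc)

sum-map-applyUpTo : ∀ (f g : ℕ → ℕ) c → sum (map f (applyUpTo g c)) ≡ ∑< c (f ∘ g)
sum-map-applyUpTo f g zero = refl
sum-map-applyUpTo f g (suc c) = cong (f (g 0) +_) (sum-map-applyUpTo f (g ∘ suc) c)

sumFromTo≡∑< : ∀ a b f → sumFromTo a b f ≡ ∑< (suc b ∸ a) (λ i → f (a + i))
sumFromTo≡∑< a b f = sum-map-applyUpTo (λ i → f (a + i)) (λ i → i) (suc b ∸ a)

∑<-cong : ∀ {g h} c → (∀ i → i < c → g i ≡ h i) → ∑< c g ≡ ∑< c h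
∑<-cong zero g≗h = refl
∑<-cong (suc c) g≗h = cong₂ _+_ (g≗h 0 (s≤s z≤n)) (∑<-cong c (λ i i<c → g≗h (suc i) (s≤s i<c)))

∑<-*ˡ : ∀ x g c → ∑< c (λ i → x * g i) ≡ x * ∑< c g
∑<-*ˡ x g zero = sym (*-zeroʳ x)
∑<-*ˡ x g (suc c) =
  trans (cong (x * g 0 +_) (∑<-*ˡ x (g ∘ suc) c)) (sym (*-distribˡ-+ x (g 0) _))

∑-∑< : (F : ℕ → A → ℕ) (c : ℕ) (xs : List A) → ∑ (λ x → ∑< c (λ i → F i x)) xs ≡ ∑< c (λ i → ∑ (F i) xs)
∑-∑< F zero xs = ∑-zero xs
∑-∑< F (suc c) xs =
  trans (∑-+ (F 0) (λ x → ∑< c (λ i → F (suc i) x)) xs) (cong (∑ (F 0) xs +_) (∑-∑< (F ∘ suc) c xs))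

∑-concatMap-applyUpTo : (f : A → ℕ) (g : ℕ → List A) (h : ℕ → ℕ) (c : ℕ) →
  ∑ f (concatMap g (applyUpTo h c)) ≡ ∑< c (λ i → ∑ f (g (h i)))
∑-concatMap-applyUpTo f g h zero = refl
∑-concatMap-applyUpTo f g h (suc c) =
  trans (∑-++ f (g (h 0)) _) (cong (∑ f (g (h 0)) +_) (∑-concatMap-applyUpTo f g (h ∘ suc) c))

∑<-pairs : ∀ g n → ∑< (2 * n) g ≡ ∑< n (λ i → g (2 * i) + g (suc (2 * i)))
∑<-pairs g zero = refl
∑<-pairs g (suc n) = begin
  ∑< (2 * suc n) g                                ≡⟨ cong (λ m → ∑< m g) (*-suc 2 n) ⟩
  g 0 + (g 1 + ∑< (2 * n) (g ∘ suc ∘ suc))        ≡⟨ +-assoc (g 0) (g 1) _ ⟨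
  g 0 + g 1 + ∑< (2 * n) (g ∘ suc ∘ suc)          ≡⟨ cong (g 0 + g 1 +_) (∑<-pairs (g ∘ suc ∘ suc) n) ⟩
  g 0 + g 1 + ∑< n (λ i → g (2 + 2 * i) + g (3 + 2 * i))
    ≡⟨ cong (g 0 + g 1 +_) (∑<-cong n λ i _ → cong (λ j → g j + g (suc j)) (sym (*-suc 2 i))) ⟩
  ∑< (suc n) (λ i → g (2 * i) + g (suc (2 * i))) ∎
  where open ≡-Reasoning

∑<-δ : ∀ p a c → ∑< c (λ i → δ p (a + i)) ≡ 𝟙 ((a ≤? p) ×-dec (p <? a + c))
∑<-δ p a zero =
  sym (𝟙-no (in? a (a + 0)) λ (a≤p , p<a+0) → <⇒≱ (subst (p <_) (+-identityʳ a) p<a+0) a≤p)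
  where in? = λ a b → (a ≤? p) ×-dec (p <? b)
∑<-δ p a (suc c) = begin
  δ p (a + 0) + ∑< c (λ i → δ p (a + suc i))
    ≡⟨ cong₂ _+_ (cong (δ p) (+-identityʳ a)) (∑<-cong c λ i _ → cong (δ p) (+-suc a i)) ⟩
  δ p a + ∑< c (λ i → δ p (suc a + i))    ≡⟨ cong (δ p a +_) (∑<-δ p (suc a) c) ⟩
  δ p a + 𝟙 (in? (suc a) (suc a + c))     ≡⟨ split (<-cmp p a) ⟩
  𝟙 (in? a (a + suc c))                   ∎
  where
  open ≡-Reasoning
  in? = λ a b → (a ≤? p) ×-dec (p <? b)
  split : Tri (p < a) (p ≡ a) (a < p) → δ p a + 𝟙 (in? (suc a) (suc a + c)) ≡ 𝟙 (in? a (a + suc c))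
  split (tri< p<a _ _) = begin
    δ p a + 𝟙 (in? (suc a) (suc a + c))
      ≡⟨ cong₂ _+_ (𝟙-no (p ≟ a) (<⇒≢ p<a)) (𝟙-no (in? (suc a) (suc a + c)) λ (a<p , _) → <-asym p<a a<p) ⟩
    0                                  ≡⟨ 𝟙-no (in? a (a + suc c)) (λ (a≤p , _) → <⇒≱ p<a a≤p) ⟨
    𝟙 (in? a (a + suc c))              ∎
  split (tri≈ _ refl _) = begin
    δ p p + 𝟙 (in? (suc p) (suc p + c))
      ≡⟨ cong₂ _+_ (δ-refl p) (𝟙-no (in? (suc p) (suc p + c)) λ (p<p , _) → <-irrefl refl p<p) ⟩
    1                                  ≡⟨ 𝟙-yes (in? p (suc p + c)) (≤-refl , m≤m+n (suc p) c) ⟨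
    𝟙 (in? p (suc p + c))              ≡⟨ cong (𝟙 ∘ in? p) (+-suc p c) ⟨
    𝟙 (in? p (p + suc c))              ∎
  split (tri> _ p≢a a<p) = cong₂ _+_ (𝟙-no (p ≟ a) p≢a)
    (𝟙-⇔ (mk⇔ (λ (a<p , p<) → <⇒≤ a<p , subst (p <_) (sym (+-suc a c)) p<)
               (λ (_ , p<) → a<p , subst (p <_) (+-suc a c) p<))
         (in? (suc a) (suc a + c)) (in? a (a + suc c)))

∑-concatMap-pair : (f : A → ℕ) (a b : A → A) (xs : List A) →
  ∑ f (concatMap (λ x → a x ∷ b x ∷ []) xs) ≡ ∑ (f ∘ a) xs + ∑ (f ∘ b) xs
∑-concatMap-pair f a b [] = refl
∑-concatMap-pair f a b (x ∷ xs) = begin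
  f (a x) + (f (b x) + ∑ f (concatMap (λ x → a x ∷ b x ∷ []) xs))
    ≡⟨ cong (λ t → f (a x) + (f (b x) + t)) (∑-concatMap-pair f a b xs) ⟩
  f (a x) + (f (b x) + (∑ (f ∘ a) xs + ∑ (f ∘ b) xs))    ≡⟨ +-assoc (f (a x)) (f (b x)) _ ⟨
  f (a x) + f (b x) + (∑ (f ∘ a) xs + ∑ (f ∘ b) xs)      ≡⟨ +-interchange (f (a x)) (f (b x)) _ _ ⟩
  f (a x) + ∑ (f ∘ a) xs + (f (b x) + ∑ (f ∘ b) xs)      ∎
  where open ≡-Reasoning

∑-words-suc : (f : List Step → ℕ) (L : ℕ) →
  ∑ f (words (suc L)) ≡ ∑ (f ∘ (U ∷_)) (words L) + ∑ (f ∘ (D ∷_)) (words L)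
∑-words-suc f L = ∑-concatMap-pair f (U ∷_) (D ∷_) (words L)

∑-words-cong : ∀ L {f g : List Step → ℕ} → (∀ w → length w ≡ L → f w ≡ g w) →
  ∑ f (words L) ≡ ∑ g (words L)
∑-words-cong zero f≗g = cong (_+ 0) (f≗g [] refl)
∑-words-cong (suc L) {f} {g} f≗g = begin
  ∑ f (words (suc L))                                      ≡⟨ ∑-words-suc f L ⟩
  ∑ (f ∘ (U ∷_)) (words L) + ∑ (f ∘ (D ∷_)) (words L)
    ≡⟨ cong₂ _+_ (∑-words-cong L λ w |w| → f≗g (U ∷ w) (cong suc |w|))
                 (∑-words-cong L λ w |w| → f≗g (D ∷ w) (cong suc |w|)) ⟩
  ∑ (g ∘ (U ∷_)) (words L) + ∑ (g ∘ (D ∷_)) (words L)    ≡⟨ ∑-words-suc g L ⟨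
  ∑ g (words (suc L))                                      ∎
  where open ≡-Reasoning

-- Pascal's rule as the definition: unlike _C_, it computes on constructors.
choose : ℕ → ℕ → ℕ
choose n zero = 1
choose zero (suc k) = 0
choose (suc n) (suc k) = choose n k + choose n (suc k)

choose≡C : ∀ n k → choose n k ≡ n C k
choose≡C n zero = refl
choose≡C zero (suc k) = refl
choose≡C (suc n) (suc k) =
  trans (cong₂ _+_ (choose≡C n k) (choose≡C n (suc k))) (nCk+nC[k+1]≡[n+1]C[k+1] n k)

choose-1 : ∀ n → choose n 1 ≡ n
choose-1 zero = refl
choose-1 (suc n) = cong suc (choose-1 n)

choose-absorb : ∀ n k → choose (suc n) (suc k) * suc k ≡ suc n * choose n k
choose-absorb zero zero = refl
choose-absorb zero (suc k) = refl
choose-absorb (suc n) zero =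
  trans (*-identityʳ _) (trans (choose-1 (2 + n)) (sym (*-identityʳ (2 + n))))
choose-absorb (suc n) (suc k) = begin
  (a + b) * suc (suc k)
    ≡⟨ distribute a b k ⟩
  a * suc k + b * suc (suc k) + a
    ≡⟨ cong₂ (λ x y → x + y + a) (choose-absorb n k) (choose-absorb n (suc k)) ⟩
  suc n * choose n k + suc n * choose n (suc k) + (choose n k + choose n (suc k))
    ≡⟨ collect n (choose n k) (choose n (suc k)) ⟩
  suc (suc n) * (choose n k + choose n (suc k)) ∎
  where
  open ≡-Reasoning
  a = choose (suc n) (suc k)
  b = choose (suc n) (suc (suc k))
  distribute : ∀ a b k → (a + b) * suc (suc k) ≡ a * suc k + b * suc (suc k) + a
  distribute = solve-∀
  collect : ∀ n x y → suc n * x + suc n * y + (x + y) ≡ suc (suc n) * (x + y)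
  collect = solve-∀

length≡numU+numD : ∀ w → length w ≡ numU w + numD w
length≡numU+numD [] = refl
length≡numU+numD (U ∷ w) = cong suc (length≡numU+numD w)
length≡numU+numD (D ∷ w) = trans (cong suc (length≡numU+numD w)) (sym (+-suc (numU w) (numD w)))

IsDyck⇒length≡ : ∀ {w} → IsDyck w → length w ≡ 2 * numU w
IsDyck⇒length≡ {w} (U≡D , _) =
  trans (length≡numU+numD w) (cong (numU w +_) (trans (sym U≡D) (sym (+-identityʳ (numU w)))))

lower : Maybe ℕ → Maybe ℕ
lower (just (suc h)) = just h
lower _ = nothing

lower≡just : ∀ x {h} → lower x ≡ just h → x ≡ just (suc h)
lower≡just (just (suc x)) refl = refl

-- startHeight w ≡ just h iff w, walked from height h, ends at height 0 without going below 0.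
startHeight : List Step → Maybe ℕ
startHeight [] = just 0
startHeight (U ∷ w) = lower (startHeight w)
startHeight (D ∷ w) = Maybe.map suc (startHeight w)

map-suc≢just0 : ∀ x → Maybe.map suc x ≢ just 0
map-suc≢just0 nothing ()
map-suc≢just0 (just x) ()

NonNegFrom : ℕ → List Step → Set
NonNegFrom c w = All (λ p → numD p ≤ c + numU p) (inits w)

startHeight-sound : ∀ w c → startHeight w ≡ just c → NonNegFrom c w × numD w ≡ c + numU w
startHeight-sound [] .0 refl = z≤n ∷ [] , refl
startHeight-sound (D ∷ w) zero e = ⊥-elim (map-suc≢just0 (startHeight w) e)
startHeight-sound (D ∷ w) (suc c) e
  with nonNeg , D≡ ← startHeight-sound w c (Maybe.map-injective suc-injective e)
  = z≤n ∷ map⁺ (All.map s≤s nonNeg) , cong suc D≡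
startHeight-sound (U ∷ w) c e
  with nonNeg , D≡ ← startHeight-sound w (suc c) (lower≡just (startHeight w) e)
  = z≤n ∷ map⁺ (All.map (λ {p} → subst (numD p ≤_) (sym (+-suc c (numU p)))) nonNeg)
  , trans D≡ (sym (+-suc c (numU w)))

startHeight-complete : ∀ w c → NonNegFrom c w → numD w ≡ c + numU w → startHeight w ≡ just c
startHeight-complete [] c _ D≡ = cong just (trans D≡ (+-identityʳ c))
startHeight-complete (D ∷ w) zero (_ ∷ nonNeg) D≡ with map⁻ nonNeg
... | () ∷ _
startHeight-complete (D ∷ w) (suc c) (_ ∷ nonNeg) D≡ =
  cong (Maybe.map suc) (startHeight-complete w c (All.map s≤s⁻¹ (map⁻ nonNeg)) (suc-injective D≡))
startHeight-complete (U ∷ w) c (_ ∷ nonNeg) D≡ = cong lower (startHeight-complete w (suc c)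
  (All.map (λ {p} → subst (numD p ≤_) (+-suc c (numU p))) (map⁻ nonNeg))
  (trans D≡ (+-suc c (numU w))))

IsDyck⇔startHeight≡0 : ∀ w → IsDyck w ⇔ (startHeight w ≡ just 0)
IsDyck⇔startHeight≡0 w = mk⇔
  (λ (U≡D , nonNeg) → startHeight-complete w 0 nonNeg (sym U≡D))
  (λ h≡0 → let nonNeg , D≡U = startHeight-sound w 0 h≡0 in sym D≡U , nonNeg)

_≟ᴴ_ : (x y : Maybe Step) → Dec (x ≡ y)
_≟ᴴ_ = Maybe.≡-dec _≟S_

startsWith : Maybe Step → List Step → ℕ
startsWith s w = 𝟙 (head w ≟ᴴ s)

peaks : List Step → ℕ
peaks [] = 0
peaks (U ∷ w) = startsWith (just D) w + peaks w
peaks (D ∷ w) = peaks w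

peaks≤numU : ∀ w → peaks w ≤ numU w
peaks≤numU [] = z≤n
peaks≤numU (D ∷ w) = peaks≤numU w
peaks≤numU (U ∷ []) = z≤n
peaks≤numU (U ∷ D ∷ w) = s≤s (peaks≤numU w)
peaks≤numU (U ∷ U ∷ w) = m≤n⇒m≤1+n (peaks≤numU (U ∷ w))

1≤peaks : ∀ w {h} → startHeight w ≡ just h → 1 ≤ numU w → 1 ≤ peaks w
1≤peaks (D ∷ w) {zero} sh _ = ⊥-elim (map-suc≢just0 (startHeight w) sh)
1≤peaks (D ∷ w) {suc h} sh 1≤u = 1≤peaks w (Maybe.map-injective suc-injective sh) 1≤u
1≤peaks (U ∷ D ∷ w) _ _ = s≤s z≤n
1≤peaks (U ∷ U ∷ w) sh _ = 1≤peaks (U ∷ w) (lower≡just (startHeight (U ∷ w)) sh) (s≤s z≤n)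

D⊆ : ∀ w h → startHeight w ≡ just (suc h) → (D ∷ []) ⊆ w
D⊆ (D ∷ w) h _ = refl ∷ minimum w
D⊆ (U ∷ w) h sh = U ∷ʳ D⊆ w (suc h) (lower≡just (startHeight w) sh)

UD⊆ : ∀ w → startHeight w ≡ just 0 → 1 ≤ numU w → UD ⊆ w
UD⊆ (D ∷ w) sh _ = ⊥-elim (map-suc≢just0 (startHeight w) sh)
UD⊆ (U ∷ w) sh _ = refl ∷ D⊆ w 0 (lower≡just (startHeight w) sh)

flip : Step → Step
flip U = D
flip D = U

alternating : Step → ℕ → List Step
alternating s zero = []
alternating s (suc L) = s ∷ alternating (flip s) L

UD^≡alternating : ∀ n → UD^ n ≡ alternating U (n + n)
UD^≡alternating zero = refl
UD^≡alternating (suc n) =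
  trans (cong (λ w → U ∷ D ∷ w) (UD^≡alternating n)) (cong (λ m → U ∷ alternating D m) (sym (+-suc n n)))

-- cost s w is the length of the shortest prefix of alternating s containing w as a subword.
cost : Step → List Step → ℕ
cost s [] = 0
cost U (U ∷ w) = suc (cost D w)
cost U (D ∷ w) = 2 + cost U w
cost D (D ∷ w) = suc (cost U w)
cost D (U ∷ w) = 2 + cost D w

cost≤suc-cost-flip : ∀ s w → cost s w ≤ suc (cost (flip s) w)
cost≤suc-cost-flip s [] = z≤n
cost≤suc-cost-flip U (U ∷ w) = s≤s (m≤n+m (cost D w) 2)
cost≤suc-cost-flip U (D ∷ w) = ≤-refl
cost≤suc-cost-flip D (D ∷ w) = s≤s (m≤n+m (cost U w) 2)
cost≤suc-cost-flip D (U ∷ w) = ≤-refl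

⊆-alternating⇒cost≤ : ∀ s L w → w ⊆ alternating s L → cost s w ≤ L
⊆-alternating⇒cost≤ s zero .[] [] = z≤n
⊆-alternating⇒cost≤ s (suc L) w (.s ∷ʳ w⊆) =
  ≤-trans (cost≤suc-cost-flip s w) (s≤s (⊆-alternating⇒cost≤ (flip s) L w w⊆))
⊆-alternating⇒cost≤ U (suc L) (.U ∷ w) (refl ∷ w⊆) = s≤s (⊆-alternating⇒cost≤ D L w w⊆)
⊆-alternating⇒cost≤ D (suc L) (.D ∷ w) (refl ∷ w⊆) = s≤s (⊆-alternating⇒cost≤ U L w w⊆)

cost≤⇒⊆-alternating : ∀ s L w → cost s w ≤ L → w ⊆ alternating s L
cost≤⇒⊆-alternating s L [] _ = minimum (alternating s L)
cost≤⇒⊆-alternating U (suc L) (U ∷ w) (s≤s c≤L) = refl ∷ cost≤⇒⊆-alternating D L w c≤L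
cost≤⇒⊆-alternating U (suc L) (D ∷ w) (s≤s c≤L) = U ∷ʳ cost≤⇒⊆-alternating D L (D ∷ w) c≤L
cost≤⇒⊆-alternating D (suc L) (D ∷ w) (s≤s c≤L) = refl ∷ cost≤⇒⊆-alternating U L w c≤L
cost≤⇒⊆-alternating D (suc L) (U ∷ w) (s≤s c≤L) = D ∷ʳ cost≤⇒⊆-alternating U L (U ∷ w) c≤L

+2-on-both-sides : ∀ c p l → c + 2 * p ≡ 2 * l → 2 + c + 2 * p ≡ 2 * suc l
+2-on-both-sides c p l e = trans (cong (2 +_) e) (sym (*-suc 2 l))

cost+2*peaks : ∀ w → startHeight w ≢ nothing → cost U w + 2 * peaks w ≡ 2 * length w
cost+2*peaks [] _ = refl
cost+2*peaks (D ∷ w) defined =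
  +2-on-both-sides (cost U w) (peaks w) (length w) (cost+2*peaks w (defined ∘ cong (Maybe.map suc)))
cost+2*peaks (U ∷ []) defined = ⊥-elim (defined refl)
cost+2*peaks (U ∷ U ∷ w) defined =
  +2-on-both-sides (cost U (U ∷ w)) (peaks (U ∷ w)) (suc (length w))
    (cost+2*peaks (U ∷ w) (defined ∘ cong lower))
cost+2*peaks (U ∷ D ∷ w) defined = begin
  2 + c + 2 * suc p        ≡⟨ shuffle c p ⟩
  2 + (2 + c) + 2 * p      ≡⟨ +2-on-both-sides (2 + c) p (suc l) (+2-on-both-sides c p l IH) ⟩
  2 * suc (suc l)          ∎
  where
  open ≡-Reasoning
  c = cost U w
  p = peaks w
  l = length w
  IH = cost+2*peaks w (defined ∘ cong (lower ∘ Maybe.map suc))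
  shuffle : ∀ c p → 2 + c + 2 * suc p ≡ 2 + (2 + c) + 2 * p
  shuffle = solve-∀

cost≤⇔peaks≥ : ∀ c p k n → c + 2 * p ≡ 2 * (2 * k) → (c ≤ n + n ⇔ 2 * k ∸ n ≤ p)
cost≤⇔peaks≥ c p k n c+2p≡ = mk⇔ to from
  where
  open ≤-Reasoning
  regroup : ∀ n p → n + n + 2 * p ≡ 2 * (n + p)
  regroup = solve-∀
  to : c ≤ n + n → 2 * k ∸ n ≤ p
  to c≤ = m≤n+o⇒m∸n≤o (2 * k) n (*-cancelˡ-≤ 2 (begin
    2 * (2 * k)       ≡⟨ c+2p≡ ⟨
    c + 2 * p         ≤⟨ +-monoˡ-≤ (2 * p) c≤ ⟩
    n + n + 2 * p     ≡⟨ regroup n p ⟩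
    2 * (n + p)       ∎))
  from : 2 * k ∸ n ≤ p → c ≤ n + n
  from ≤p = +-cancelʳ-≤ (2 * p) c (n + n) (begin
    c + 2 * p         ≡⟨ c+2p≡ ⟩
    2 * (2 * k)       ≤⟨ *-monoʳ-≤ 2 (≤-trans (m≤n+m∸n (2 * k) n) (+-monoʳ-≤ n ≤p)) ⟩
    2 * (n + p)       ≡⟨ regroup n p ⟨
    n + n + 2 * p     ∎)

dyck-⊆-UD^⇔ : ∀ n k w → IsDyck w → numU w ≡ k → (w ⊆ UD^ n ⇔ 2 * k ∸ n ≤ peaks w)
dyck-⊆-UD^⇔ n k w dyck numU≡k = mk⇔
  (Equivalence.to cost⇔ ∘ ⊆-alternating⇒cost≤ U (n + n) w ∘ subst (w ⊆_) (UD^≡alternating n))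
  (subst (w ⊆_) (sym (UD^≡alternating n)) ∘ cost≤⇒⊆-alternating U (n + n) w ∘ Equivalence.from cost⇔)
  where
  height0 = Equivalence.to (IsDyck⇔startHeight≡0 w) dyck
  length≡ : length w ≡ 2 * k
  length≡ = trans (IsDyck⇒length≡ dyck) (cong (2 *_) numU≡k)
  cost⇔ : cost U w ≤ n + n ⇔ 2 * k ∸ n ≤ peaks w
  cost⇔ = cost≤⇔peaks≥ (cost U w) (peaks w) k n
    (trans (cost+2*peaks w (λ undefined → case trans (sym height0) undefined of λ ()))
           (cong (2 *_) length≡))

_≟ᴹ_ : (x y : Maybe ℕ) → Dec (x ≡ y)
_≟ᴹ_ = Maybe.≡-dec _≟_

atHeight : ℕ → List Step → ℕ
atHeight h w = 𝟙 (startHeight w ≟ᴹ just h)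

pathWeight : ℕ → ℕ → ℕ → List Step → ℕ
pathWeight u h m w = atHeight h w * δ (numU w) u * δ (peaks w) m

-- The first letter is tracked (nothing: the empty word) because U followed by D makes a peak.
weight : Maybe Step → ℕ → ℕ → ℕ → List Step → ℕ
weight s u h m w = startsWith s w * pathWeight u h m w

pathWeight-split : ∀ u h m w →
  pathWeight u h m w ≡ weight (just D) u h m w + weight (just U) u h m w + weight nothing u h m w
pathWeight-split u h m [] = lemma (pathWeight u h m [])
  where lemma : ∀ x → x ≡ 0 * x + 0 * x + 1 * x
        lemma = solve-∀
pathWeight-split u h m (U ∷ w) = lemma (pathWeight u h m (U ∷ w))
  where lemma : ∀ x → x ≡ 0 * x + 1 * x + 0 * x
        lemma = solve-∀
pathWeight-split u h m (D ∷ w) = lemma (pathWeight u h m (D ∷ w))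
  where lemma : ∀ x → x ≡ 1 * x + 0 * x + 0 * x
        lemma = solve-∀

atHeight-D : ∀ h w → atHeight (suc h) (D ∷ w) ≡ atHeight h w
atHeight-D h w with startHeight w
... | nothing = refl
... | just _ = refl

atHeight0-D : ∀ w → atHeight 0 (D ∷ w) ≡ 0
atHeight0-D w with startHeight w
... | nothing = refl
... | just _ = refl

atHeight-U : ∀ h w → atHeight h (U ∷ w) ≡ atHeight (suc h) w
atHeight-U h w with startHeight w
... | nothing = refl
... | just zero = refl
... | just (suc _) = refl

pathWeight-D : ∀ u h m w → pathWeight u (suc h) m (D ∷ w) ≡ pathWeight u h m w
pathWeight-D u h m w = cong (λ a → a * δ (numU w) u * δ (peaks w) m) (atHeight-D h w)

pathWeight0-D : ∀ u m w → pathWeight u 0 m (D ∷ w) ≡ 0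
pathWeight0-D u m w = cong (λ a → a * δ (numU w) u * δ (peaks w) m) (atHeight0-D w)

pathWeight-U : ∀ u h m w → pathWeight (suc u) h (suc m) (U ∷ w) ≡
  weight (just D) u (suc h) m w + weight (just U) u (suc h) (suc m) w
pathWeight-U u h m [] = refl
pathWeight-U u h m (D ∷ w) = begin
  atHeight h (U ∷ D ∷ w) * δ (numU w) u * δ (peaks w) m
    ≡⟨ cong (λ a → a * δ (numU w) u * δ (peaks w) m) (atHeight-U h (D ∷ w)) ⟩
  pathWeight u (suc h) m (D ∷ w)            ≡⟨ lemma (pathWeight u (suc h) m (D ∷ w)) ⟩
  1 * pathWeight u (suc h) m (D ∷ w) + 0    ∎
  where
  open ≡-Reasoning
  lemma : ∀ x → x ≡ 1 * x + 0
  lemma = solve-∀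
pathWeight-U u h m (U ∷ w) = trans
  (cong (λ a → a * δ (numU (U ∷ w)) u * δ (peaks (U ∷ w)) (suc m)) (atHeight-U h (U ∷ w)))
  (sym (+-identityʳ _))

pathWeight-U0 : ∀ u h w → pathWeight (suc u) h 0 (U ∷ w) ≡ weight (just U) u (suc h) 0 w
pathWeight-U0 u h [] = refl
pathWeight-U0 u h (D ∷ w) = *-zeroʳ (atHeight h (U ∷ D ∷ w) * δ (numU w) u)
pathWeight-U0 u h (U ∷ w) = trans
  (cong (λ a → a * δ (numU (U ∷ w)) u * δ (peaks (U ∷ w)) 0) (atHeight-U h (U ∷ w)))
  (sym (+-identityʳ _))

pathWeight-U-no-up : ∀ h m w → pathWeight 0 h m (U ∷ w) ≡ 0
pathWeight-U-no-up h m w = cong (_* δ (peaks (U ∷ w)) m) (*-zeroʳ (atHeight h (U ∷ w)))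

#paths : Maybe Step → ℕ → ℕ → ℕ → ℕ → ℕ
#paths s L u h m = ∑ (weight s u h m) (words L)

∑-pathWeight : ∀ L u h m → ∑ (pathWeight u h m) (words L) ≡
  #paths (just D) L u h m + #paths (just U) L u h m + #paths nothing L u h m
∑-pathWeight L u h m = begin
  ∑ (pathWeight u h m) (words L)
    ≡⟨ ∑-cong (words L) (pathWeight-split u h m) ⟩
  ∑ (λ w → weight (just D) u h m w + weight (just U) u h m w + weight nothing u h m w) (words L)
    ≡⟨ ∑-+ (λ w → weight (just D) u h m w + weight (just U) u h m w) (weight nothing u h m) (words L) ⟩
  ∑ (λ w → weight (just D) u h m w + weight (just U) u h m w) (words L) + #paths nothing L u h m
    ≡⟨ cong (_+ #paths nothing L u h m) (∑-+ (weight (just D) u h m) (weight (just U) u h m) (words L)) ⟩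
  #paths (just D) L u h m + #paths (just U) L u h m + #paths nothing L u h m ∎
  where open ≡-Reasoning

#D-first-step : ∀ L u h m → #paths (just D) (suc L) u h m ≡ ∑ (pathWeight u h m ∘ (D ∷_)) (words L)
#D-first-step L u h m = begin
  #paths (just D) (suc L) u h m
    ≡⟨ ∑-words-suc (weight (just D) u h m) L ⟩
  ∑ (λ _ → 0) (words L) + ∑ (λ w → pathWeight u h m (D ∷ w) + 0) (words L)
    ≡⟨ cong₂ _+_ (∑-zero (words L)) (∑-cong (words L) λ w → +-identityʳ _) ⟩
  ∑ (pathWeight u h m ∘ (D ∷_)) (words L) ∎
  where open ≡-Reasoning

#U-first-step : ∀ L u h m → #paths (just U) (suc L) u h m ≡ ∑ (pathWeight u h m ∘ (U ∷_)) (words L)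
#U-first-step L u h m = begin
  #paths (just U) (suc L) u h m
    ≡⟨ ∑-words-suc (weight (just U) u h m) L ⟩
  ∑ (λ w → pathWeight u h m (U ∷ w) + 0) (words L) + ∑ (λ _ → 0) (words L)
    ≡⟨ cong₂ _+_ (∑-cong (words L) λ w → +-identityʳ _) (∑-zero (words L)) ⟩
  ∑ (pathWeight u h m ∘ (U ∷_)) (words L) + 0
    ≡⟨ +-identityʳ _ ⟩
  ∑ (pathWeight u h m ∘ (U ∷_)) (words L) ∎
  where open ≡-Reasoning

#∅-suc : ∀ L u h m → #paths nothing (suc L) u h m ≡ 0
#∅-suc L u h m =
  trans (∑-words-suc (weight nothing u h m) L) (cong₂ _+_ (∑-zero (words L)) (∑-zero (words L)))

#∅-up : ∀ L u h m → #paths nothing L (suc u) h m ≡ 0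
#∅-up zero u h m =
  trans (+-identityʳ _) (trans (+-identityʳ _) (cong (_* δ 0 m) (*-zeroʳ (atHeight h []))))
#∅-up (suc L) u h m = #∅-suc L (suc u) h m

#D-suc : ∀ L u h m → #paths (just D) (suc L) u (suc h) m ≡
  #paths (just D) L u h m + #paths (just U) L u h m + #paths nothing L u h m
#D-suc L u h m = trans (#D-first-step L u (suc h) m)
  (trans (∑-cong (words L) (pathWeight-D u h m)) (∑-pathWeight L u h m))

#D-suc-up : ∀ L u h m → #paths (just D) (suc L) (suc u) (suc h) m ≡
  #paths (just D) L (suc u) h m + #paths (just U) L (suc u) h m
#D-suc-up L u h m = trans (#D-suc L (suc u) h m)
  (trans (cong (#paths (just D) L (suc u) h m + #paths (just U) L (suc u) h m +_) (#∅-up L u h m))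
         (+-identityʳ _))

#D-at-zero : ∀ L u m → #paths (just D) L u 0 m ≡ 0
#D-at-zero zero u m = refl
#D-at-zero (suc L) u m = trans (#D-first-step L u 0 m)
  (trans (∑-cong (words L) (pathWeight0-D u m)) (∑-zero (words L)))

#U-suc : ∀ L u h m → #paths (just U) (suc L) (suc u) h (suc m) ≡
  #paths (just D) L u (suc h) m + #paths (just U) L u (suc h) (suc m)
#U-suc L u h m = trans (#U-first-step L (suc u) h (suc m))
  (trans (∑-cong (words L) (pathWeight-U u h m))
         (∑-+ (weight (just D) u (suc h) m) (weight (just U) u (suc h) (suc m)) (words L)))

#U-no-up : ∀ L h m → #paths (just U) L 0 h m ≡ 0
#U-no-up zero h m = refl
#U-no-up (suc L) h m = trans (#U-first-step L 0 h m)
  (trans (∑-cong (words L) (pathWeight-U-no-up h m)) (∑-zero (words L)))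

#U-no-peaks : ∀ L u h → #paths (just U) L u h 0 ≡ 0
#U-no-peaks zero u h = refl
#U-no-peaks (suc L) zero h = #U-no-up (suc L) h 0
#U-no-peaks (suc L) (suc u) h = trans (#U-first-step L (suc u) h 0)
  (trans (∑-cong (words L) (pathWeight-U0 u h)) (#U-no-peaks L u (suc h)))

#D-no-peaks : ∀ L u h → #paths (just D) L (suc u) h 0 ≡ 0
#D-no-peaks zero u h = refl
#D-no-peaks (suc L) u zero = #D-at-zero (suc L) (suc u) 0
#D-no-peaks (suc L) u (suc h) = trans (#D-suc-up L u h 0)
  (cong₂ _+_ (#D-no-peaks L u h) (#U-no-peaks L (suc u) h))

#D-descent : ∀ h m → #paths (just D) (suc h) 0 (suc h) m ≡ δ 0 m
#D-descent zero m = trans (#D-suc 0 0 0 m) (simplify (δ 0 m))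
  where simplify : ∀ x → 0 + 0 + (1 * (1 * 1 * x) + 0) ≡ x
        simplify = solve-∀
#D-descent (suc h) m = begin
  #paths (just D) (2 + h) 0 (2 + h) m
    ≡⟨ #D-suc (suc h) 0 (suc h) m ⟩
  #paths (just D) (suc h) 0 (suc h) m + #paths (just U) (suc h) 0 (suc h) m
    + #paths nothing (suc h) 0 (suc h) m
    ≡⟨ cong₂ _+_ (cong₂ _+_ (#D-descent h m) (#U-no-up (suc h) (suc h) m)) (#∅-suc h 0 (suc h) m) ⟩
  δ 0 m + 0 + 0
    ≡⟨ trans (+-identityʳ _) (+-identityʳ _) ⟩
  δ 0 m ∎
  where open ≡-Reasoning

add-shared-factorˡ : ∀ {a b} x p p′ y q q′ → a + x * p ≡ y * q → b + x * p′ ≡ y * q′ →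
  a + b + x * (p′ + p) ≡ y * (q′ + q)
add-shared-factorˡ {a} {b} x p p′ y q q′ e e′ = begin
  a + b + x * (p′ + p)        ≡⟨ regroup a b x p p′ ⟩
  (a + x * p) + (b + x * p′)  ≡⟨ cong₂ _+_ e e′ ⟩
  y * q + y * q′              ≡⟨ trans (*-distribˡ-+ y q′ q) (+-comm (y * q′) (y * q)) ⟨
  y * (q′ + q)                ∎
  where
  open ≡-Reasoning
  regroup : ∀ a b x p p′ → a + b + x * (p′ + p) ≡ (a + x * p) + (b + x * p′)
  regroup = solve-∀

add-shared-factorʳ : ∀ {a b} x x′ p y y′ q → a + x * p ≡ y * q → b + x′ * p ≡ y′ * q →
  a + b + (x + x′) * p ≡ (y + y′) * q
add-shared-factorʳ {a} {b} x x′ p y y′ q e e′ = begin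
  a + b + (x + x′) * p        ≡⟨ regroup a b x x′ p ⟩
  (a + x * p) + (b + x′ * p)  ≡⟨ cong₂ _+_ e e′ ⟩
  y * q + y′ * q              ≡⟨ *-distribʳ-+ q y y′ ⟨
  (y + y′) * q                ∎
  where
  open ≡-Reasoning
  regroup : ∀ a b x x′ p → a + b + (x + x′) * p ≡ (a + x * p) + (b + x′ * p)
  regroup = solve-∀

-- A path with s + 1 up-steps from height h to 0 has length 2 (s + 1) + h.
shorter-by-height : ∀ {L} s h → suc L ≡ 2 * suc s + suc h → L ≡ 2 * suc s + h
shorter-by-height s h eq = suc-injective (trans eq (+-suc (2 * suc s) h))

shorter-by-up : ∀ {L} s h → suc L ≡ 2 * (2 + s) + h → L ≡ 2 * suc s + suc h
shorter-by-up s h eq = suc-injective (trans eq (regroup s h))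
  where regroup : ∀ s h → 2 * (2 + s) + h ≡ suc (2 * suc s + suc h)
        regroup = solve-∀

#U-one-peak : ∀ L s h → L ≡ 2 * suc s + h → #paths (just U) L (suc s) h 1 ≡ 1
#U-one-peak (suc L) zero h eq = begin
  #paths (just U) (suc L) 1 h 1
    ≡⟨ #U-suc L 0 h 0 ⟩
  #paths (just D) L 0 (suc h) 0 + #paths (just U) L 0 (suc h) 1
    ≡⟨ cong₂ _+_ (trans (cong (λ L → #paths (just D) L 0 (suc h) 0) (suc-injective eq)) (#D-descent h 0))
                 (#U-no-up L (suc h) 1) ⟩
  1 ∎
  where open ≡-Reasoning
#U-one-peak (suc L) (suc s) h eq = begin
  #paths (just U) (suc L) (2 + s) h 1
    ≡⟨ #U-suc L (suc s) h 0 ⟩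
  #paths (just D) L (suc s) (suc h) 0 + #paths (just U) L (suc s) (suc h) 1
    ≡⟨ cong₂ _+_ (#D-no-peaks L s (suc h)) (#U-one-peak L s (suc h) (shorter-by-up s h eq)) ⟩
  1 ∎
  where open ≡-Reasoning

-- Ballot-type differences, with the subtracted term moved to the left.
#D-closed : ∀ L s h t → L ≡ 2 * suc s + h →
  #paths (just D) L (suc s) h (suc t) + choose s (suc t) * choose (s + h) t ≡
  choose s t * choose (s + h) (suc t)
#U-closed : ∀ L s h t → L ≡ 2 * suc s + h →
  #paths (just U) L (suc s) h (2 + t) + choose s (2 + t) * choose (s + h) t ≡
  choose s (suc t) * choose (s + h) (suc t)

#D-closed (suc L) s zero t eq = begin
  #paths (just D) (suc L) (suc s) 0 (suc t) + choose s (suc t) * choose (s + 0) t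
    ≡⟨ cong₂ _+_ (#D-at-zero (suc L) (suc s) (suc t))
                 (cong (λ n → choose s (suc t) * choose n t) (+-identityʳ s)) ⟩
  choose s (suc t) * choose s t
    ≡⟨ *-comm (choose s (suc t)) (choose s t) ⟩
  choose s t * choose s (suc t)
    ≡⟨ cong (λ n → choose s t * choose n (suc t)) (+-identityʳ s) ⟨
  choose s t * choose (s + 0) (suc t) ∎
  where open ≡-Reasoning
#D-closed (suc L) s (suc h) t eq =
  subst (λ n → #paths (just D) (suc L) (suc s) (suc h) (suc t) + choose s (suc t) * choose n t ≡
               choose s t * choose n (suc t))
        (sym (+-suc s h)) (closed t)
  where
  L≡ = shorter-by-height s h eq
  closed : ∀ t → #paths (just D) (suc L) (suc s) (suc h) (suc t) + choose s (suc t) * choose (suc (s + h)) t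
                 ≡ choose s t * choose (suc (s + h)) (suc t)
  closed zero = trans (cong (_+ choose s 1 * 1) (#D-suc-up L s h 1))
    (add-shared-factorˡ (choose s 1) 1 0 1 (choose (s + h) 1) 1 (#D-closed L s h 0 L≡)
      (cong₂ _+_ (#U-one-peak L s h L≡) (*-zeroʳ (choose s 1))))
  closed (suc t) = trans (cong (_+ _) (#D-suc-up L s h (2 + t)))
    (add-shared-factorˡ (choose s (2 + t)) (choose (s + h) (suc t)) (choose (s + h) t)
                        (choose s (suc t)) (choose (s + h) (2 + t)) (choose (s + h) (suc t))
                        (#D-closed L s h (suc t) L≡) (#U-closed L s h t L≡))

#U-closed (suc L) zero h t eq = begin
  #paths (just U) (suc L) 1 h (2 + t) + 0
    ≡⟨ +-identityʳ _ ⟩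
  #paths (just U) (suc L) 1 h (2 + t)
    ≡⟨ #U-suc L 0 h (suc t) ⟩
  #paths (just D) L 0 (suc h) (suc t) + #paths (just U) L 0 (suc h) (2 + t)
    ≡⟨ cong₂ _+_ (trans (cong (λ L → #paths (just D) L 0 (suc h) (suc t)) (suc-injective eq))
                        (#D-descent h (suc t)))
                 (#U-no-up L (suc h) (2 + t)) ⟩
  0 ∎
  where open ≡-Reasoning
#U-closed (suc L) (suc s) h t eq = begin
  #paths (just U) (suc L) (2 + s) h (2 + t) + choose (suc s) (2 + t) * choose (suc s + h) t
    ≡⟨ cong₂ _+_ (#U-suc L (suc s) h (suc t))
                 (cong (λ n → choose (suc s) (2 + t) * choose n t) (sym (+-suc s h))) ⟩
  #paths (just D) L (suc s) (suc h) (suc t) + #paths (just U) L (suc s) (suc h) (2 + t)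
    + choose (suc s) (2 + t) * choose (s + suc h) t
    ≡⟨ add-shared-factorʳ (choose s (suc t)) (choose s (2 + t)) (choose (s + suc h) t)
                          (choose s t) (choose s (suc t)) (choose (s + suc h) (suc t))
                          (#D-closed L s (suc h) t L≡) (#U-closed L s (suc h) t L≡) ⟩
  choose (suc s) (suc t) * choose (s + suc h) (suc t)
    ≡⟨ cong (λ n → choose (suc s) (suc t) * choose n (suc t)) (+-suc s h) ⟩
  choose (suc s) (suc t) * choose (suc s + h) (suc t) ∎
  where
  open ≡-Reasoning
  L≡ = shorter-by-up s h eq

narayana-algebra : ∀ X x y z a S → X + z * y ≡ x * x → (y + x) * a ≡ S * y → (x + z) * suc a ≡ S * x →
  X * (a * suc a) ≡ S * x * y
narayana-algebra X x y z a S X+zy≡xx yx≡Sy xz≡Sx = +-cancelʳ-≡ K _ _ (begin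
  X * (a * suc a) + K                              ≡⟨ expand₁ X x y z a ⟩
  (X + z * y) * (a * suc a) + x * y * (a * suc a)
                                                   ≡⟨ cong (λ t → t * (a * suc a) + x * y * (a * suc a)) X+zy≡xx ⟩
  x * x * (a * suc a) + x * y * (a * suc a)        ≡⟨ expand₂ x y a ⟩
  x * suc a * ((y + x) * a)                        ≡⟨ cong (x * suc a *_) yx≡Sy ⟩
  x * suc a * (S * y)                              ≡⟨ expand₃ x y a S ⟩
  S * x * y + y * a * (S * x)                      ≡⟨ cong (λ t → S * x * y + y * a * t) xz≡Sx ⟨
  S * x * y + y * a * ((x + z) * suc a)            ≡⟨ expand₄ x y z a S ⟩
  S * x * y + K                                    ∎)
  where
  open ≡-Reasoning
  K = z * y * (a * suc a) + x * y * (a * suc a)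
  expand₁ : ∀ X x y z a → X * (a * suc a) + (z * y * (a * suc a) + x * y * (a * suc a))
                         ≡ (X + z * y) * (a * suc a) + x * y * (a * suc a)
  expand₁ = solve-∀
  expand₂ : ∀ x y a → x * x * (a * suc a) + x * y * (a * suc a) ≡ x * suc a * ((y + x) * a)
  expand₂ = solve-∀
  expand₃ : ∀ x y a S → x * suc a * (S * y) ≡ S * x * y + y * a * (S * x)
  expand₃ = solve-∀
  expand₄ : ∀ x y z a S → S * x * y + y * a * ((x + z) * suc a)
                         ≡ S * x * y + (z * y * (a * suc a) + x * y * (a * suc a))
  expand₄ = solve-∀

narayana-numerator : ∀ X s r → X + choose s (2 + r) * choose s r ≡ choose s (suc r) * choose s (suc r) →
  X * suc s ≡ choose (suc s) (2 + r) * choose (suc s) (suc r)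
narayana-numerator X s r X+zy≡xx = *-cancelʳ-≡ _ _ (suc r * suc (suc r)) (begin
  X * S * (a * suc a)                             ≡⟨ reassoc₁ X S a ⟩
  S * (X * (a * suc a))                           ≡⟨ cong (S *_) (narayana-algebra X x y z a S X+zy≡xx
                                                        (choose-absorb s r) (choose-absorb s (suc r))) ⟩
  S * (S * x * y)                                 ≡⟨ reassoc₂ S x y ⟩
  (S * x) * (S * y)
    ≡⟨ cong₂ _*_ (choose-absorb s (suc r)) (choose-absorb s r) ⟨
  (choose S (suc a) * suc a) * (choose S a * a)   ≡⟨ reassoc₃ (choose S (suc a)) (choose S a) a ⟩
  choose S (suc a) * choose S a * (a * suc a)     ∎)
  where
  open ≡-Reasoning
  x = choose s (suc r)
  y = choose s r
  z = choose s (2 + r)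
  a = suc r
  S = suc s
  reassoc₁ : ∀ X S a → X * S * (a * suc a) ≡ S * (X * (a * suc a))
  reassoc₁ = solve-∀
  reassoc₂ : ∀ S x y → S * (S * x * y) ≡ (S * x) * (S * y)
  reassoc₂ = solve-∀
  reassoc₃ : ∀ p q a → (p * suc a) * (q * a) ≡ p * q * (a * suc a)
  reassoc₃ = solve-∀

#U-dyck≡narayana : ∀ s m → 1 ≤ m → #paths (just U) (2 * suc s) (suc s) 0 m ≡ narayana (suc s) m
#U-dyck≡narayana s 1 _ = begin
  #paths (just U) (2 * suc s) (suc s) 0 1   ≡⟨ #U-one-peak (2 * suc s) s 0 (sym (+-identityʳ _)) ⟩
  1                                          ≡⟨ n/n≡1 (suc s) ⟨
  suc s / suc s
    ≡⟨ cong (_/ suc s) (trans (*-identityʳ (suc s C 1)) (nC1≡n (suc s))) ⟨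
  narayana (suc s) 1                         ∎
  where open ≡-Reasoning
#U-dyck≡narayana s (suc (suc r)) _ = begin
  X                                                          ≡⟨ m*n/n≡m X (suc s) ⟨
  X * suc s / suc s
    ≡⟨ cong (_/ suc s) (narayana-numerator X s r closed) ⟩
  choose (suc s) (2 + r) * choose (suc s) (suc r) / suc s
    ≡⟨ cong (_/ suc s) (cong₂ _*_ (choose≡C (suc s) (2 + r)) (choose≡C (suc s) (suc r))) ⟩
  narayana (suc s) (2 + r)                                   ∎
  where
  open ≡-Reasoning
  X = #paths (just U) (2 * suc s) (suc s) 0 (2 + r)
  closed : X + choose s (2 + r) * choose s r ≡ choose s (suc r) * choose s (suc r)
  closed = subst (λ n → X + choose s (2 + r) * choose n r ≡ choose s (suc r) * choose n (suc r))
                 (+-identityʳ s) (#U-closed (2 * suc s) s 0 r (sym (+-identityʳ _)))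

narayana-counts-dyck-paths : ∀ k m → 1 ≤ k → 1 ≤ m → ∑ (pathWeight k 0 m) (words (2 * k)) ≡ narayana k m
narayana-counts-dyck-paths (suc s) m _ 1≤m = begin
  ∑ (pathWeight (suc s) 0 m) (words L)
    ≡⟨ ∑-pathWeight L (suc s) 0 m ⟩
  #paths (just D) L (suc s) 0 m + #paths (just U) L (suc s) 0 m + #paths nothing L (suc s) 0 m
    ≡⟨ cong₂ (λ a b → a + #paths (just U) L (suc s) 0 m + b) (#D-at-zero L (suc s) m) (#∅-up L s 0 m) ⟩
  #paths (just U) L (suc s) 0 m + 0
    ≡⟨ +-identityʳ _ ⟩
  #paths (just U) L (suc s) 0 m
    ≡⟨ #U-dyck≡narayana s m 1≤m ⟩
  narayana (suc s) m ∎
  where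
  open ≡-Reasoning
  L = 2 * suc s

module _ (n k : ℕ) (1≤k : 1 ≤ k) (k≤n : k ≤ n) where

  private
    lo = 1 ⊔ (2 * k ∸ n)
    c = suc k ∸ lo

    1≤lo : 1 ≤ lo
    1≤lo = m≤m⊔n 1 (2 * k ∸ n)

    lo≤k : lo ≤ k
    lo≤k = ⊔-lub 1≤k (subst (2 * k ∸ n ≤_) (+-identityʳ k) (m≤n+o⇒m∸n≤o (2 * k) n (+-monoˡ-≤ (k + 0) k≤n)))

    lo+c≡1+k : lo + c ≡ suc k
    lo+c≡1+k = m+[n∸m]≡n (m≤n⇒m≤1+n lo≤k)

  InIntervalRank⇔ : ∀ w → InIntervalRank n k w ⇔
    (((startHeight w ≡ just 0) × (numU w ≡ k)) × (lo ≤ peaks w × peaks w < lo + c))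
  InIntervalRank⇔ w = mk⇔
    (λ (dyck , _ , ⊆UD^ , numU≡k) →
      let height0 = Equivalence.to (IsDyck⇔startHeight≡0 w) dyck in
        (height0 , numU≡k)
      , ⊔-lub (1≤peaks w height0 (subst (1 ≤_) (sym numU≡k) 1≤k))
              (Equivalence.to (dyck-⊆-UD^⇔ n k w dyck numU≡k) ⊆UD^)
      , subst (peaks w <_) (sym lo+c≡1+k) (s≤s (subst (peaks w ≤_) numU≡k (peaks≤numU w))))
    (λ ((height0 , numU≡k) , lo≤peaks , _) →
      let dyck = Equivalence.from (IsDyck⇔startHeight≡0 w) height0 in
        dyck
      , UD⊆ w height0 (subst (1 ≤_) (sym numU≡k) 1≤k)
      , Equivalence.from (dyck-⊆-UD^⇔ n k w dyck numU≡k) (≤-trans (m≤n⊔m 1 (2 * k ∸ n)) lo≤peaks)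
      , numU≡k)

  𝟙-InIntervalRank : ∀ w → 𝟙 (InIntervalRank? n k w) ≡ ∑< c (λ i → pathWeight k 0 (lo + i) w)
  𝟙-InIntervalRank w = begin
    𝟙 (InIntervalRank? n k w)
      ≡⟨ 𝟙-⇔ (InIntervalRank⇔ w) (InIntervalRank? n k w) (shape? ×-dec range?) ⟩
    𝟙 (shape? ×-dec range?)
      ≡⟨ 𝟙-× shape? range? ⟩
    𝟙 shape? * 𝟙 range?
      ≡⟨ cong₂ _*_ (𝟙-× (startHeight w ≟ᴹ just 0) (numU w ≟ k)) (sym (∑<-δ (peaks w) lo c)) ⟩
    atHeight 0 w * δ (numU w) k * ∑< c (λ i → δ (peaks w) (lo + i))
      ≡⟨ ∑<-*ˡ (atHeight 0 w * δ (numU w) k) (λ i → δ (peaks w) (lo + i)) c ⟨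
    ∑< c (λ i → pathWeight k 0 (lo + i) w) ∎
    where
    open ≡-Reasoning
    shape? = (startHeight w ≟ᴹ just 0) ×-dec (numU w ≟ k)
    range? = (lo ≤? peaks w) ×-dec (peaks w <? lo + c)

  rankCount≡ : rankCount n k ≡ sumFromTo lo k (narayana k)
  rankCount≡ = begin
    rankCount n k
      ≡⟨ length-filter (InIntervalRank? n k) (words (2 * k)) ⟩
    ∑ (𝟙 ∘ InIntervalRank? n k) (words (2 * k))
      ≡⟨ ∑-cong (words (2 * k)) 𝟙-InIntervalRank ⟩
    ∑ (λ w → ∑< c (λ i → pathWeight k 0 (lo + i) w)) (words (2 * k))
      ≡⟨ ∑-∑< (λ i → pathWeight k 0 (lo + i)) c (words (2 * k)) ⟩
    ∑< c (λ i → ∑ (pathWeight k 0 (lo + i)) (words (2 * k)))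
      ≡⟨ ∑<-cong c (λ i _ → narayana-counts-dyck-paths k (lo + i) 1≤k (≤-trans 1≤lo (m≤m+n lo i))) ⟩
    ∑< c (λ i → narayana k (lo + i))
      ≡⟨ sumFromTo≡∑< lo k (narayana k) ⟨
    sumFromTo lo k (narayana k) ∎
    where open ≡-Reasoning

∑-InInterval-odd : ∀ n i → ∑ (𝟙 ∘ InInterval? n) (words (suc (2 * i))) ≡ 0
∑-InInterval-odd n i = trans
  (∑-words-cong (suc (2 * i)) λ w |w| → 𝟙-no (InInterval? n w) λ (dyck , _) →
    even≢odd (numU w) i (trans (sym (IsDyck⇒length≡ dyck)) |w|))
  (∑-zero (words (suc (2 * i))))

∑-InInterval-even : ∀ n k → ∑ (𝟙 ∘ InInterval? n) (words (2 * k)) ≡ rankCount n k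
∑-InInterval-even n k = trans
  (∑-words-cong (2 * k) λ w |w| → 𝟙-⇔
    (mk⇔ (λ (dyck , UD⊆ , ⊆UD^) →
           dyck , UD⊆ , ⊆UD^ , *-cancelˡ-≡ (numU w) k 2 (trans (sym (IsDyck⇒length≡ dyck)) |w|))
         (λ (dyck , UD⊆ , ⊆UD^ , _) → dyck , UD⊆ , ⊆UD^))
    (InInterval? n w) (InIntervalRank? n k w))
  (sym (length-filter (InIntervalRank? n k) (words (2 * k))))

intervalCount≡ : ∀ n → intervalCount n ≡ sumFromTo 1 n (λ k → sumFromTo (1 ⊔ (2 * k ∸ n)) k (narayana k))
intervalCount≡ n = begin
  intervalCount n
    ≡⟨ length-filter (InInterval? n) (wordsUpTo (2 * n)) ⟩
  ∑ (𝟙 ∘ InInterval? n) (wordsUpTo (2 * n))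
    ≡⟨ ∑-concatMap-applyUpTo (𝟙 ∘ InInterval? n) words (λ L → L) (suc (2 * n)) ⟩
  count 0 + ∑< (2 * n) (count ∘ suc)
    ≡⟨ cong (_+ ∑< (2 * n) (count ∘ suc)) (𝟙-no (InInterval? n []) λ ()) ⟩
  ∑< (2 * n) (count ∘ suc)
    ≡⟨ ∑<-pairs (count ∘ suc) n ⟩
  ∑< n (λ i → count (suc (2 * i)) + count (2 + 2 * i))
    ≡⟨ ∑<-cong n (λ i i<n → cong₂ _+_ (∑-InInterval-odd n i) (begin
         count (2 + 2 * i)          ≡⟨ cong count (*-suc 2 i) ⟨
         count (2 * suc i)          ≡⟨ ∑-InInterval-even n (suc i) ⟩
         rankCount n (suc i)        ≡⟨ rankCount≡ n (suc i) (s≤s z≤n) i<n ⟩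
         F (suc i)                  ∎)) ⟩
  ∑< n (λ i → F (suc i))
    ≡⟨ sumFromTo≡∑< 1 n F ⟨
  sumFromTo 1 n F ∎
  where
  open ≡-Reasoning
  F = λ k → sumFromTo (1 ⊔ (2 * k ∸ n)) k (narayana k)
  count = λ L → ∑ (𝟙 ∘ InInterval? n) (words L)

mainTheorem3 : (n : ℕ) → 0 < n →
    ((k : ℕ) → 1 ≤ k → k ≤ n →
      rankCount n k ≡ sumFromTo (1 ⊔ (2 * k ∸ n)) k (narayana k))
    × (intervalCount n ≡
        sumFromTo 1 n (λ k → sumFromTo (1 ⊔ (2 * k ∸ n)) k (narayana k)))
mainTheorem3 n _ = rankCount≡ n , intervalCount≡ n
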